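{- For the subset sum problem with positive integer weights $w_1\ge\dots\ge w_n$ and positive integer capacity $C$, any two distinct leaf $1$-tuples of its MBnB tree are incomparable in the componentwise order on $\{0,1\}^n$.
   Context: Let $N=\{1,\dots,n\}$, $W=\sum_{i\in N}w_i$. A map is a pair $(I,\theta)$ with $I\subseteq N$, $\theta:I\to\{0,1\}$. It satisfies the C0-condition if $\sum_{i\in I}\theta(i)w_i>C$, and the C1-condition if $\sum_{i\in I}(1-\theta(i))w_i\ge W-C$. The MBnB tree: the root is $(\emptyset,\emptyset)$; a node satisfying the C0- or C1-condition is a leaf; otherwise (then $I\ne N$) with $i$ the smallest index of $N\setminus I$ the node has two children $(I\cup\{i\},\theta_0)$, $(I\cup\{i\},\theta_1)$ where $\theta_k$ extends $\theta$ by $\theta_k(i)=k$. For a leaf $(I,\theta)$ satisfying the C0-condition, its leaf $0$-tuple is $z\in\{0,1\}^n$ with $z_i=\theta(i)$ for $i\in I$ and $z_i=0$ for $i\notin I$. For a leaf satisfying the C1-condition, its leaf $1$-tuple is $z$ with $z_i=\theta(i)$ for $i\in I$ and $z_i=1$ for $i\notin I$. The order on $\{0,1\}^n$ is $\tilde\alpha\le\tilde\beta$ iff $\alpha_i\le\beta_i$ for all $i$. -}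

module Defs where

open import Data.Bool using (Bool; true; false; if_then_else_; not)
open import Data.Nat using (ℕ; zero; suc; _+_; _∸_; _<_; _≤_)
open import Data.List using (List; []; _∷_; _++_; [_]; length; zipWith; replicate)
open import Data.Nat.ListAction using (sum)
open import Data.Product using (_×_)
open import Relation.Nullary using (¬_)

-- A node (I , θ) of the MBnB tree always has I = {1,…,k} (a prefix of N),
-- so it is represented by the list  θ(1) ∷ … ∷ θ(k)  of its values.

sum0 : List ℕ → List Bool → ℕ
sum0 w θ = sum (zipWith (λ b x → if b then x else 0) θ w)

sum1 : List ℕ → List Bool → ℕ
sum1 w θ = sum (zipWith (λ b x → if b then 0 else x) θ w)

C0 : List ℕ → ℕ → List Bool → Set
C0 w C θ = C < sum0 w θ

-- C1-condition:  Σ (1-θ(i)) wᵢ ≥ W - C   (W ∸ C is exact when W ≥ C;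
-- when W < C both readings are trivially true since the left side is ≥ 0)
C1 : List ℕ → ℕ → List Bool → Set
C1 w C θ = sum w ∸ C ≤ sum1 w θ

data InTree (w : List ℕ) (C : ℕ) : List Bool → Set where
  root  : InTree w C []
  child : ∀ {θ} → InTree w C θ → ¬ C0 w C θ → ¬ C1 w C θ →
          length θ < length w → (b : Bool) → InTree w C (θ ++ [ b ])

Leaf1 : List ℕ → ℕ → List Bool → Set
Leaf1 w C θ = InTree w C θ × C1 w C θ

tuple1 : List ℕ → List Bool → List Bool
tuple1 w θ = θ ++ replicate (length w ∸ length θ) true

module Submission where

-- Put T = W ∸ C.  A C1-leaf θ of the MBnB tree is exactly a branch
-- whose "rejected weight" Σ (1-θ(i)) wᵢ reaches T for the first time at its
-- last position: every proper prefix stays below T (its parent node failed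
-- the C1-condition), while θ itself reaches T.  We call such branches
-- first-reaching.  For weights sorted non-increasingly, two first-reaching
-- branches θ, θ′ whose 1-tuples satisfy t(θ) ≤ t(θ′) must coincide: walk
-- along the common prefix; at the first difference θ rejects an item of
-- weight y that θ′ accepts.  Everything θ rejects afterwards is a run of
-- items of weight ≤ y that stops as soon as it crosses the remaining budget,
-- so it stays strictly below the whole budget T, whereas θ′ — rejecting a
-- subset of what θ rejects on that tail (t(θ) ≤ t(θ′)) — reaches T.

open import Defs
open import Data.Nat using (ℕ; _<_; _≥_)
open import Data.Bool using (Bool)
open import Data.Bool.Base using () renaming (_≤_ to _≤ᵇ_)
open import Data.List using (List)
open import Data.List.Relation.Unary.All using (All)
open import Data.List.Relation.Unary.Linked using (Linked)
open import Data.List.Relation.Binary.Pointwise using (Pointwise)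
open import Data.Product using (_×_)
open import Relation.Nullary using (¬_)
open import Relation.Binary.PropositionalEquality using (_≢_)

open import Data.Bool.Base using (true; false; if_then_else_; b≤b; f≤t)
open import Data.Nat using (zero; suc; _+_; _∸_; _≤_; z≤n; s≤s)
open import Data.Nat.Properties
open import Data.List using ([]; _∷_; _++_; [_]; length; replicate)
open import Data.List.Relation.Unary.All using ([]; _∷_)
open import Data.List.Relation.Unary.AllPairs using (AllPairs; []; _∷_)
open import Data.List.Relation.Unary.Linked.Properties using (Linked⇒AllPairs)
open import Data.List.Relation.Binary.Pointwise using ([]; _∷_)
open import Data.Nat.ListAction using (sum)
open import Data.Product using (_,_)
open import Relation.Nullary using (contradiction)
open import Relation.Binary.PropositionalEquality using (_≡_; refl; cong; sym; subst; subst₂)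

-- The weight an item of weight x adds to Σ (1-θ(i)) wᵢ when θ(i) = b;
-- `sum1 (x ∷ w) (b ∷ θ)` unfolds to `rejected b x + sum1 w θ`.
rejected : Bool → ℕ → ℕ
rejected b x = if b then 0 else x

rejected≤weight : ∀ b x → rejected b x ≤ x
rejected≤weight true  x = z≤n
rejected≤weight false x = ≤-refl

sum1-ones : ∀ w k → sum1 w (replicate k true) ≡ 0
sum1-ones []      zero    = refl
sum1-ones []      (suc k) = refl
sum1-ones (x ∷ w) zero    = refl
sum1-ones (x ∷ w) (suc k) = sum1-ones w k

sum1-padded : ∀ w θ k → sum1 w (θ ++ replicate k true) ≡ sum1 w θ
sum1-padded w       []      k = sum1-ones w k
sum1-padded []      (b ∷ θ) k = refl
sum1-padded (x ∷ w) (b ∷ θ) k = cong (rejected b x +_) (sum1-padded w θ k)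

sum1-antitone : ∀ w {t t′} → Pointwise _≤ᵇ_ t t′ → sum1 w t′ ≤ sum1 w t
sum1-antitone []      []                    = z≤n
sum1-antitone []      (_ ∷ _)               = z≤n
sum1-antitone (x ∷ w) []                    = z≤n
sum1-antitone (x ∷ w) (b≤b {true}  ∷ t≤t′) = sum1-antitone w t≤t′
sum1-antitone (x ∷ w) (b≤b {false} ∷ t≤t′) = +-monoʳ-≤ x (sum1-antitone w t≤t′)
sum1-antitone (x ∷ w) (f≤t ∷ t≤t′)         = m≤n⇒m≤o+n x (sum1-antitone w t≤t′)

tuple1-antitone : ∀ w θ θ′ → Pointwise _≤ᵇ_ (tuple1 w θ) (tuple1 w θ′) →
                  sum1 w θ′ ≤ sum1 w θ
tuple1-antitone w θ θ′ t≤t′ =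
  subst₂ _≤_ (sum1-padded w θ′ _) (sum1-padded w θ _) (sum1-antitone w t≤t′)

-- Unreached T w θ: θ is a branch over the weights w none of whose proper
-- prefixes has rejected weight ≥ T.  The budget index decreases along the
-- branch by the weight rejected so far.
data Unreached : ℕ → List ℕ → List Bool → Set where
  []  : ∀ {T w} → Unreached T w []
  _∷_ : ∀ {T x w b θ} → 0 < T → Unreached (T ∸ rejected b x) w θ →
        Unreached T (x ∷ w) (b ∷ θ)

FirstReaching : ℕ → List ℕ → List Bool → Set
FirstReaching T w θ = Unreached T w θ × T ≤ sum1 w θ

budget-positive : ∀ {T w b θ} → Unreached T w (b ∷ θ) → 0 < T
budget-positive (0<T ∷ _) = 0<T

unreached-extend : ∀ {T} w θ b → Unreached T w θ → sum1 w θ < T →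
                   length θ < length w → Unreached T w (θ ++ [ b ])
unreached-extend (x ∷ w) []      b []         0<T _ = 0<T ∷ []
unreached-extend {T} (x ∷ w) (c ∷ θ) b (0<T ∷ u) below (s≤s fits) =
  0<T ∷ unreached-extend w θ b u below′ fits
  where
  below′ : sum1 w θ < T ∸ rejected c x
  below′ = m+n≤o⇒m≤o∸n (suc (sum1 w θ))
             (subst (_≤ T) (cong suc (+-comm (rejected c x) (sum1 w θ))) below)

node-unreached : ∀ {w C θ} → InTree w C θ → Unreached (sum w ∸ C) w θ
node-unreached root                        = []
node-unreached {w} (child {θ} t _ ¬c1 fits b) =
  unreached-extend w θ b (node-unreached t) (≰⇒> ¬c1) fits

leaf1-firstReaching : ∀ w C θ → Leaf1 w C θ → FirstReaching (sum w ∸ C) w θ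
leaf1-firstReaching w C θ (t , c1) = node-unreached t , c1

-- Overshoot bound: an unreached non-empty branch over weights ≤ y can pass
-- its budget S by less than y, because only its last item may cross S.
overshoot : ∀ {S y w b θ} → Unreached S w (b ∷ θ) → All (y ≥_) w →
            sum1 w (b ∷ θ) < S + y
overshoot {S} {y} {x ∷ w} {b} {[]} (0<S ∷ []) (x≤y ∷ _) = begin-strict
  rejected b x + 0 ≡⟨ +-identityʳ _ ⟩
  rejected b x     ≤⟨ ≤-trans (rejected≤weight b x) x≤y ⟩
  y                <⟨ m<n+m y 0<S ⟩
  S + y            ∎
  where open ≤-Reasoning
overshoot {S} {y} {x ∷ w} {b} {c ∷ θ} (_ ∷ u) (_ ∷ w≤y) = begin-strict
  r + sum1 w (c ∷ θ) <⟨ +-monoʳ-< r (overshoot u w≤y) ⟩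
  r + (S ∸ r + y)    ≡⟨ sym (+-assoc r (S ∸ r) y) ⟩
  r + (S ∸ r) + y    ≡⟨ cong (_+ y) (m+[n∸m]≡n r≤S) ⟩
  S + y              ∎
  where
  open ≤-Reasoning
  r = rejected b x
  r≤S : r ≤ S
  r≤S = <⇒≤ (m∸n≢0⇒n<m (n>0⇒n≢0 (budget-positive u)))

-- After rejecting an item of weight y, a branch over lighter items can no
-- longer reach the full budget T: the tail has budget T ∸ y and overshoots
-- it by less than y.
rejection-bound : ∀ {T y w θ} → Unreached T (y ∷ w) (false ∷ θ) →
                  All (y ≥_) w → sum1 w θ < T
rejection-bound {θ = []}    (0<T ∷ [])  _   = 0<T
rejection-bound {T} {y} {θ = b ∷ θ} (_ ∷ u) w≤y =
  subst (_ <_) (m∸n+n≡m y≤T) (overshoot u w≤y)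
  where
  y≤T : y ≤ T
  y≤T = <⇒≤ (m∸n≢0⇒n<m (n>0⇒n≢0 (budget-positive u)))

firstReaching-unique : ∀ {T} w θ θ′ → AllPairs _≥_ w →
  FirstReaching T w θ → FirstReaching T w θ′ →
  Pointwise _≤ᵇ_ (tuple1 w θ) (tuple1 w θ′) → θ ≡ θ′
firstReaching-unique w [] [] _ _ _ _ = refl
firstReaching-unique w [] (_ ∷ _) _ (_ , reach) (u′ , _) _ =
  contradiction reach (<⇒≱ (budget-positive u′))
firstReaching-unique w (_ ∷ _) [] _ (u , _) (_ , reach′) _ =
  contradiction reach′ (<⇒≱ (budget-positive u))
firstReaching-unique {T} (x ∷ w) (b ∷ θ) (.b ∷ θ′) (_ ∷ sorted)
  (_ ∷ u , reach) (_ ∷ u′ , reach′) (b≤b ∷ t≤t′) =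
  cong (b ∷_) (firstReaching-unique w θ θ′ sorted
    (u , m≤n+o⇒m∸n≤o T (rejected b x) reach)
    (u′ , m≤n+o⇒m∸n≤o T (rejected b x) reach′) t≤t′)
firstReaching-unique (x ∷ w) (false ∷ θ) (true ∷ θ′) (x≥w ∷ _)
  (u , _) (_ , reach′) (f≤t ∷ t≤t′) =
  contradiction (≤-trans reach′ (tuple1-antitone w θ θ′ t≤t′))
                (<⇒≱ (rejection-bound u x≥w))

proposition6 : (w : List ℕ) (C : ℕ) →
    All (λ x → 0 < x) w → Linked _≥_ w → 0 < C →
    (θ θ′ : List Bool) → Leaf1 w C θ → Leaf1 w C θ′ →
    tuple1 w θ ≢ tuple1 w θ′ →
    ¬ Pointwise _≤ᵇ_ (tuple1 w θ) (tuple1 w θ′) × ¬ Pointwise _≤ᵇ_ (tuple1 w θ′) (tuple1 w θ)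
proposition6 w C _ linked _ θ θ′ leaf leaf′ distinct =
  (λ t≤t′ → distinct (cong (tuple1 w) (unique θ θ′ leaf leaf′ t≤t′))) ,
  (λ t′≤t → distinct (cong (tuple1 w) (sym (unique θ′ θ leaf′ leaf t′≤t))))
  where
  unique : ∀ θ θ′ → Leaf1 w C θ → Leaf1 w C θ′ →
           Pointwise _≤ᵇ_ (tuple1 w θ) (tuple1 w θ′) → θ ≡ θ′
  unique θ θ′ leaf leaf′ =
    firstReaching-unique w θ θ′ (Linked⇒AllPairs (λ a b → ≤-trans b a) linked)
      (leaf1-firstReaching w C θ leaf) (leaf1-firstReaching w C θ′ leaf′)
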